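{- Let $P$ be a GP 2 program that does not contain the command $\mathtt{break}$, and let $c$ be an assertion which is an invariant of $P$, i.e. $\{c\}\,P\,\{c\}$ is partially correct. Then the triple $\{c\}\,P!\,\{c\wedge\mathrm{FAIL}(P)\}$ is partially correct.
   Context: GP 2 host graphs have finite node/edge sets, source/target maps, node/edge labels (a list of integers and strings together with a mark) and rooted/unrooted nodes. GP 2 programs are built from rule set calls of conditional rule schemata, $\mathtt{break}$, $\mathtt{skip}$, $\mathtt{fail}$, sequential composition, $\mathtt{or}$, $\mathtt{if}$/$\mathtt{try}$-$\mathtt{then}$-$\mathtt{else}$ and the loop $P!$. Execution is a small-step relation $\to$ on configurations $\langle P,G\rangle$, host graphs and $\mathrm{fail}$; $[\![P]\!]G$ is the set of host graphs and $\mathrm{fail}$ reachable from $\langle P,G\rangle$ by $\to^+$, together with $\bot$ if $P$ can diverge or get stuck. For loops: $\langle P!,G\rangle\to\langle P!,H\rangle$ if $\langle P,G\rangle\to^+H$ for a host graph $H$; $\langle P!,G\rangle\to G$ if $\langle P,G\rangle\to^+\mathrm{fail}$; $\langle P!,G\rangle\to H$ if $\langle P,G\rangle\to^*\langle\mathtt{break},H\rangle$. Assertions are arbitrary properties of host graphs. $G\models\mathrm{FAIL}(P)$ iff $\mathrm{fail}\in[\![P]\!]G$. A triple $\{c\}\,P\,\{d\}$ is partially correct if for every host graph $G$ with $G\models c$ and every host graph $H\in[\![P]\!]G$, $H\models d$. -}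

module Defs where

open import Data.Product using (Σ; _×_)
open import Relation.Nullary using (¬_)
open import Data.Unit using (⊤)

-- GP 2 programs over an abstract type RS of rule sets
-- (a rule set call {r1,...,rn} of conditional rule schemata).
data Prog (RS : Set) : Set where
  call      : RS → Prog RS
  break     : Prog RS
  skip      : Prog RS
  fail      : Prog RS
  _⨾_       : Prog RS → Prog RS → Prog RS
  _or_      : Prog RS → Prog RS → Prog RS
  if_then_else_  : Prog RS → Prog RS → Prog RS → Prog RS
  try_then_else_ : Prog RS → Prog RS → Prog RS → Prog RS
  _!        : Prog RS → Prog RS

NoBreak : {RS : Set} → Prog RS → Set
NoBreak (call _) = ⊤
NoBreak break = Data.Empty.⊥
  where import Data.Empty
NoBreak skip = ⊤
NoBreak fail = ⊤
NoBreak (P ⨾ Q) = NoBreak P × NoBreak Q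
NoBreak (P or Q) = NoBreak P × NoBreak Q
NoBreak (if C then P else Q) = NoBreak C × NoBreak P × NoBreak Q
NoBreak (try C then P else Q) = NoBreak C × NoBreak P × NoBreak Q
NoBreak (P !) = NoBreak P

module GP (HG : Set) (RS : Set) (_⇒[_]_ : HG → RS → HG → Set) where

  data Conf : Set where
    ⟨_,_⟩  : Prog RS → HG → Conf
    graph  : HG → Conf
    failC  : Conf

  infix 4 _⟶_ _⟶⁺_ _⟶*_

  mutual
    data _⟶_ : Conf → Conf → Set where
      call₁ : ∀ {R G H} → G ⇒[ R ] H → ⟨ call R , G ⟩ ⟶ graph H
      call₂ : ∀ {R G} → ¬ (Σ HG λ H → G ⇒[ R ] H) → ⟨ call R , G ⟩ ⟶ failC
      skip₁ : ∀ {G} → ⟨ skip , G ⟩ ⟶ graph G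
      fail₁ : ∀ {G} → ⟨ fail , G ⟩ ⟶ failC
      seq₁  : ∀ {P P' Q G H} → ⟨ P , G ⟩ ⟶ ⟨ P' , H ⟩ → ⟨ P ⨾ Q , G ⟩ ⟶ ⟨ P' ⨾ Q , H ⟩
      seq₂  : ∀ {P Q G H} → ⟨ P , G ⟩ ⟶ graph H → ⟨ P ⨾ Q , G ⟩ ⟶ ⟨ Q , H ⟩
      seq₃  : ∀ {P Q G} → ⟨ P , G ⟩ ⟶ failC → ⟨ P ⨾ Q , G ⟩ ⟶ failC
      brk   : ∀ {P G} → ⟨ break ⨾ P , G ⟩ ⟶ ⟨ break , G ⟩
      or₁   : ∀ {P Q G} → ⟨ P or Q , G ⟩ ⟶ ⟨ P , G ⟩
      or₂   : ∀ {P Q G} → ⟨ P or Q , G ⟩ ⟶ ⟨ Q , G ⟩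
      if₁   : ∀ {C P Q G H} → ⟨ C , G ⟩ ⟶⁺ graph H → ⟨ if C then P else Q , G ⟩ ⟶ ⟨ P , G ⟩
      if₂   : ∀ {C P Q G} → ⟨ C , G ⟩ ⟶⁺ failC → ⟨ if C then P else Q , G ⟩ ⟶ ⟨ Q , G ⟩
      try₁  : ∀ {C P Q G H} → ⟨ C , G ⟩ ⟶⁺ graph H → ⟨ try C then P else Q , G ⟩ ⟶ ⟨ P , H ⟩
      try₂  : ∀ {C P Q G} → ⟨ C , G ⟩ ⟶⁺ failC → ⟨ try C then P else Q , G ⟩ ⟶ ⟨ Q , G ⟩
      alap₁ : ∀ {P G H} → ⟨ P , G ⟩ ⟶⁺ graph H → ⟨ P ! , G ⟩ ⟶ ⟨ P ! , H ⟩
      alap₂ : ∀ {P G} → ⟨ P , G ⟩ ⟶⁺ failC → ⟨ P ! , G ⟩ ⟶ graph G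
      alap₃ : ∀ {P G H} → ⟨ P , G ⟩ ⟶* ⟨ break , H ⟩ → ⟨ P ! , G ⟩ ⟶ graph H

    data _⟶⁺_ : Conf → Conf → Set where
      [_] : ∀ {x y} → x ⟶ y → x ⟶⁺ y
      _∷_ : ∀ {x y z} → x ⟶ y → y ⟶⁺ z → x ⟶⁺ z

    data _⟶*_ : Conf → Conf → Set where
      ε   : ∀ {x} → x ⟶* x
      _∷_ : ∀ {x y z} → x ⟶ y → y ⟶* z → x ⟶* z

  Assertion : Set₁
  Assertion = HG → Set

  _∈⟦_⟧_ : HG → Prog RS → HG → Set
  H ∈⟦ P ⟧ G = ⟨ P , G ⟩ ⟶⁺ graph H

  FAIL : Prog RS → Assertion
  FAIL P G = ⟨ P , G ⟩ ⟶⁺ failC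

  _∧_ : Assertion → Assertion → Assertion
  (c ∧ d) G = c G × d G

  PartiallyCorrect : Assertion → Prog RS → Assertion → Set
  PartiallyCorrect c P d = ∀ G H → c G → H ∈⟦ P ⟧ G → d H

-- Without break, a run of P ! can only end by a failing body (alap₂), so the
-- final graph is one on which P fails; every completed body run (alap₁) keeps
-- the invariant c, so by induction on the run c holds at the end as well.
module Submission where

open import Defs
open import Data.Product using (_×_; _,_)
open import Data.Unit using (⊤; tt)
open import Data.Empty using (⊥-elim)
open import Relation.Nullary using (¬_)

module BreakFree (HG RS : Set) (_⇒[_]_ : HG → RS → HG → Set) where
  open GP HG RS _⇒[_]_

  NoBreakConf : Conf → Set
  NoBreakConf ⟨ Q , _ ⟩ = NoBreak Q
  NoBreakConf (graph _) = ⊤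
  NoBreakConf failC     = ⊤

  noBreak-⟶ : ∀ {x y} → x ⟶ y → NoBreakConf x → NoBreakConf y
  noBreak-⟶ (call₁ _)  _             = tt
  noBreak-⟶ (call₂ _)  _             = tt
  noBreak-⟶ skip₁      _             = tt
  noBreak-⟶ fail₁      _             = tt
  noBreak-⟶ (seq₁ s)   (nbP , nbQ)   = noBreak-⟶ s nbP , nbQ
  noBreak-⟶ (seq₂ _)   (_ , nbQ)     = nbQ
  noBreak-⟶ (seq₃ _)   _             = tt
  noBreak-⟶ brk        (() , _)
  noBreak-⟶ or₁        (nbP , _)     = nbP
  noBreak-⟶ or₂        (_ , nbQ)     = nbQ
  noBreak-⟶ (if₁ _)    (_ , nbP , _) = nbP
  noBreak-⟶ (if₂ _)    (_ , _ , nbQ) = nbQ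
  noBreak-⟶ (try₁ _)   (_ , nbP , _) = nbP
  noBreak-⟶ (try₂ _)   (_ , _ , nbQ) = nbQ
  noBreak-⟶ (alap₁ _)  nbP           = nbP
  noBreak-⟶ (alap₂ _)  _             = tt
  noBreak-⟶ (alap₃ _)  _             = tt

  noBreak-⟶* : ∀ {x y} → x ⟶* y → NoBreakConf x → NoBreakConf y
  noBreak-⟶* ε       nb = nb
  noBreak-⟶* (s ∷ r) nb = noBreak-⟶* r (noBreak-⟶ s nb)

  noBreak⇒¬⟶*break : ∀ {P G H} → NoBreak P → ¬ (⟨ P , G ⟩ ⟶* ⟨ break , H ⟩)
  noBreak⇒¬⟶*break nbP run = noBreak-⟶* run nbP

  graph-irreducible : ∀ {G x} → ¬ (graph G ⟶⁺ x)
  graph-irreducible [ () ]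
  graph-irreducible (() ∷ _)

  !-invariant-fails : ∀ {P c} → NoBreak P → PartiallyCorrect c P c →
                      ∀ {G H} → c G → ⟨ P ! , G ⟩ ⟶⁺ graph H → c H × FAIL P H
  !-invariant-fails nbP inv cG [ alap₂ fails ] = cG , fails
  !-invariant-fails nbP inv cG [ alap₃ run ]   = ⊥-elim (noBreak⇒¬⟶*break nbP run)
  !-invariant-fails nbP inv {G} cG (alap₁ body ∷ rest) =
    !-invariant-fails nbP inv (inv G _ cG body) rest
  !-invariant-fails nbP inv cG (alap₂ _ ∷ rest) = ⊥-elim (graph-irreducible rest)
  !-invariant-fails nbP inv cG (alap₃ _ ∷ rest) = ⊥-elim (graph-irreducible rest)

lemma15 : (HG RS : Set) (_⇒[_]_ : HG → RS → HG → Set)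
    (P : Prog RS) (c : HG → Set) →
    NoBreak P →
    GP.PartiallyCorrect HG RS _⇒[_]_ c P c →
    GP.PartiallyCorrect HG RS _⇒[_]_ c (P !) (GP._∧_ HG RS _⇒[_]_ c (GP.FAIL HG RS _⇒[_]_ P))
lemma15 HG RS _⇒[_]_ P c nbP inv G H cG =
  BreakFree.!-invariant-fails HG RS _⇒[_]_ nbP inv cG
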